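{- There exist absolute constants $H_0$ and $C>0$ such that the following holds. Let $p$ be a prime and let $H,H_*,a$ be positive integers with $H_*\leqslant H$, $a+H<p$, $16H_*^2H<p$ and $H_*\geqslant H_0$. Then $$\Bigl|\Bigl\{\frac{y}{a+x}\in\mathbb{F}_p ~:~ (x,y)\in[H]\times[H_*]\Bigr\}\Bigr| \geqslant C\, H_* H.$$
   Context: $[n]=\{1,\dots,n\}$; integers are viewed in $\mathbb{F}_p$ via reduction modulo $p$, and $\frac{y}{a+x}$ denotes $y(a+x)^{ -1}$ in $\mathbb{F}_p$ (note $a+x\not\equiv0\pmod p$ since $0<a+x<p$). -}

module Defs where

open import Data.Nat using (ℕ; zero; suc; _+_; _*_; _≡ᵇ_; NonZero)
open import Data.Nat.DivMod using (_%_)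
open import Data.Bool using (Bool)
open import Data.Fin using (Fin; toℕ)
open import Data.List using (List; length; filter; map; upTo; allFin)
open import Data.Bool.ListAction using (any)
open import Data.Bool.Properties using (T?)

range : ℕ → List ℕ
range n = map suc (upTo n)

-- Elements of F_p are represented by residues r ∈ Fin p (i.e. 0 ≤ r < p).
-- r = y/(a+x) in F_p  iff  r·(a+x) ≡ y (mod p)   (division by the
-- nonzero element a+x, i.e. r is the unique solution of r·(a+x) = y).
isQuotient : (p : ℕ) → .{{NonZero p}} → (a x y : ℕ) → Fin p → Bool
isQuotient p a x y r = ((toℕ r * (a + x)) % p) ≡ᵇ (y % p)

inQuotSet : (p : ℕ) → .{{NonZero p}} → (a H H* : ℕ) → Fin p → Bool
inQuotSet p a H H* r =
  any (λ x → any (λ y → isQuotient p a x y r) (range H*)) (range H)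

quotSetCard : (p : ℕ) → .{{NonZero p}} → (a H H* : ℕ) → ℕ
quotSetCard p a H H* = length (filter (λ r → T? (inQuotSet p a H H* r)) (allFin p))

-- Dirichlet's approximation theorem gives a ≡ s / t (mod p) with s / t in lowest terms,
-- 1 ≤ t ≤ 4H* and |s| · 4H* < p. Put D x = s + t x ≡ t (a + x), so that y / (a + x) = t y / D x
-- in 𝔽ₚ. For x ≤ H and y ≤ H* we have |y · D x| < p / 2, hence two pairs with the same quotient
-- satisfy y₁ · D x₂ = y₂ · D x₁ over ℤ, and when each yᵢ is coprime to D xᵢ the pairs coincide.
-- It remains to count the pairs with y ≤ H* / 8 and gcd (y, D x) = 1. The values D x are
-- coprime to t, so a given q ≥ 2 divides D x for at most (H + q) / q values of x, and since
-- ∑_{q ≥ 2} 1 / q² < 3 / 4 a sieve keeps at least 5 / 32 of all pairs.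

module Submission where

open import Defs
open import Data.Nat using (ℕ; _+_; _*_; _≤_; _<_; _≥_; NonZero)
open import Data.Nat.Primality using (Prime; prime⇒nonZero)
open import Data.Product using (Σ; _×_; _,_)

open import Level using (0ℓ)
open import Data.Bool.Base using (T; if_then_else_)
open import Data.Bool.Properties using (T?)
open import Data.Empty using (⊥-elim)
open import Data.Nat.Base using (zero; suc; _∸_; _/_; _%_; z≤n; s≤s; ≢-nonZero; >-nonZero)
open import Data.Nat.Properties
open import Data.Nat.Divisibility using (_∣_; _∣?_; divides; ∣⇒≤; ∣-antisym; ∣-trans; ∣m+n∣m⇒∣n)
open import Data.Nat.DivMod
  using (m%n<n; m≡m%n+[m/n]*n; [m+kn]%n≡m%n; m/n*n≡m; m/n*n≤m; m*n/n≡m; m/n≤m; m≥n⇒m/n>0; m<n*o⇒m/o<n)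
open import Data.Nat.GCD
  using (gcd; gcd[m,n]∣m; gcd[m,n]∣n; gcd[m,n]≡0⇒m≡0; gcd[m,n]≢0; module GCD; module Bézout)
open import Data.Nat.Coprimality
  using (Coprime; coprime?; coprime-divisor; gcd≡1⇒coprime; coprime-/gcd; coprime⇒GCD≡1; prime⇒coprime)
  renaming (sym to coprime-sym)
open import Data.Nat.Primality using (euclidsLemma)
open import Data.Fin.Base using (Fin; toℕ; fromℕ<)
open import Data.List.Base using (List; []; _∷_; _++_; length; filter; allFin)
open import Data.List.Properties using (length-++)
open import Data.List.Membership.Propositional using (_∈_; lose)
open import Data.List.Membership.Propositional.Properties
  using (∈-∃++; ∈-++⁻; ∈-++⁺ˡ; ∈-++⁺ʳ; ∈-map⁺; ∈-upTo⁺; ∈-filter⁺; ∈-allFin)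
open import Data.List.Relation.Binary.Subset.Propositional using (_⊆_)
open import Data.List.Relation.Unary.All as All using ()
open import Data.List.Relation.Unary.Any using (here; there)
open import Data.List.Relation.Unary.Any.Properties using (any⁺)
open import Data.List.Relation.Unary.AllPairs using ([]; _∷_)
open import Data.List.Relation.Unary.Unique.Propositional using (Unique)
import Data.List.Relation.Unary.Unique.Propositional.Properties as Unique
open import Data.Fin.Properties using (toℕ-fromℕ<; toℕ<n; pigeonhole)
import Data.Integer.Base as ℤ
open ℤ using (ℤ; +_; ∣_∣)
import Data.Integer.Properties as ℤ
import Data.Integer.DivMod as ℤ
import Data.Integer.Divisibility.Signed as ℤ
import Data.Integer.Tactic.RingSolver as ℤ-Solver
open import Algebra.Properties.AbelianGroup ℤ.+-0-abelianGroup
  using () renaming (∙-cancelˡ to ℤ+-cancelˡ)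
open import Data.Product using (∃-syntax; proj₁; proj₂)
open import Data.Sum.Base using (_⊎_; inj₁; inj₂)
open import Relation.Binary.PropositionalEquality
open import Relation.Nullary using (¬_; Dec; yes; no; does; ¬?; _×-dec_)
open import Relation.Unary using (Pred; Decidable)
open import Relation.Binary.Bundles using (Setoid)
import Relation.Binary.Reasoning.Setoid as SetoidReasoning
open import Data.Nat.Tactic.RingSolver using (solve-∀)
open import Algebra.Properties.CommutativeSemigroup +-commutativeSemigroup using (interchange)

-- Sums and counts over [1, n]

∑ : ℕ → (ℕ → ℕ) → ℕ
∑ zero    f = 0
∑ (suc n) f = f (suc n) + ∑ n f

indicator : {A : Set} → Dec A → ℕ
indicator A? = if does A? then 1 else 0

indicator-yes : {A : Set} (A? : Dec A) → A → 1 ≤ indicator A?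
indicator-yes (yes _) _ = s≤s z≤n
indicator-yes (no ¬a) a = ⊥-elim (¬a a)

count : {P : Pred ℕ 0ℓ} → Decidable P → ℕ → ℕ
count P? n = ∑ n (λ i → indicator (P? i))

∑-cong : ∀ n {f g : ℕ → ℕ} → (∀ i → f i ≡ g i) → ∑ n f ≡ ∑ n g
∑-cong zero    f≗g = refl
∑-cong (suc n) f≗g = cong₂ _+_ (f≗g (suc n)) (∑-cong n f≗g)

∑-const : ∀ n k → ∑ n (λ _ → k) ≡ n * k
∑-const zero    k = refl
∑-const (suc n) k = cong (_+_ k) (∑-const n k)

∑-distrib-+ : ∀ n (f g : ℕ → ℕ) → ∑ n (λ i → f i + g i) ≡ ∑ n f + ∑ n g
∑-distrib-+ zero    f g = refl
∑-distrib-+ (suc n) f g =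
  trans (cong (_+_ (f (suc n) + g (suc n))) (∑-distrib-+ n f g))
        (interchange (f (suc n)) (g (suc n)) (∑ n f) (∑ n g))

*-distribˡ-∑ : ∀ n c (f : ℕ → ℕ) → ∑ n (λ i → c * f i) ≡ c * ∑ n f
*-distribˡ-∑ zero    c f = sym (*-zeroʳ c)
*-distribˡ-∑ (suc n) c f =
  trans (cong (_+_ (c * f (suc n))) (*-distribˡ-∑ n c f)) (sym (*-distribˡ-+ c (f (suc n)) (∑ n f)))

∑-comm : ∀ m n (g : ℕ → ℕ → ℕ) → ∑ m (λ i → ∑ n (g i)) ≡ ∑ n (λ j → ∑ m (λ i → g i j))
∑-comm zero    n g = sym (trans (∑-const n 0) (*-zeroʳ n))
∑-comm (suc m) n g =
  trans (cong (_+_ (∑ n (g (suc m)))) (∑-comm m n g))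
        (sym (∑-distrib-+ n (g (suc m)) (λ j → ∑ m (λ i → g i j))))

∑-mono-≤ : ∀ n {f g : ℕ → ℕ} → (∀ i → 1 ≤ i → i ≤ n → f i ≤ g i) → ∑ n f ≤ ∑ n g
∑-mono-≤ zero    f≤g = z≤n
∑-mono-≤ (suc n) f≤g =
  +-mono-≤ (f≤g (suc n) (s≤s z≤n) ≤-refl) (∑-mono-≤ n (λ i 1≤i i≤n → f≤g i 1≤i (m≤n⇒m≤1+n i≤n)))

term≤∑ : ∀ n (f : ℕ → ℕ) {q} → 1 ≤ q → q ≤ n → f q ≤ ∑ n f
term≤∑ zero    f 1≤q q≤0 = ⊥-elim (<⇒≱ 1≤q q≤0)
term≤∑ (suc n) f {q} 1≤q q≤1+n with q ≟ suc n
... | yes refl    = m≤m+n (f (suc n)) (∑ n f)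
... | no  q≢1+n = ≤-trans (term≤∑ n f 1≤q (≤-pred (≤∧≢⇒< q≤1+n q≢1+n))) (m≤n+m (∑ n f) (f (suc n)))

module _ {P : Pred ℕ 0ℓ} (P? : Decidable P) where

  count-complement : ∀ n → count P? n + count (λ i → ¬? (P? i)) n ≡ n
  count-complement zero = refl
  count-complement (suc n) with P? (suc n)
  ... | yes _ = cong suc (count-complement n)
  ... | no  _ = trans (+-suc (count P? n) _) (cong suc (count-complement n))

  count-none : (∀ i → ¬ P i) → ∀ n → count P? n ≡ 0
  count-none ¬P zero = refl
  count-none ¬P (suc n) with P? (suc n)
  ... | yes Pi = ⊥-elim (¬P (suc n) Pi)
  ... | no  _  = count-none ¬P n

  count-×-const : {C : Set} (C? : Dec C) → ∀ n → count (λ i → C? ×-dec P? i) n ≡ indicator C? * count P? n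
  count-×-const (no  _) zero    = refl
  count-×-const (yes _) zero    = refl
  count-×-const (no ¬c) (suc n) = count-×-const (no ¬c) n
  count-×-const (yes c) (suc n) with P? (suc n)
  ... | yes _ = cong suc (count-×-const (yes c) n)
  ... | no  _ = count-×-const (yes c) n

  count≤∑count : {Q : ℕ → Pred ℕ 0ℓ} (Q? : ∀ q → Decidable (Q q)) (N n : ℕ) →
                 (∀ x → 1 ≤ x → x ≤ n → P x → ∃[ q ] 1 ≤ q × q ≤ N × Q q x) →
                 count P? n ≤ ∑ N (λ q → count (Q? q) n)
  count≤∑count Q? N zero    cover = z≤n
  count≤∑count Q? N (suc n) cover =
    ≤-trans (+-mono-≤ newest (count≤∑count Q? N n (λ x 1≤x x≤n → cover x 1≤x (m≤n⇒m≤1+n x≤n))))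
            (≤-reflexive (sym (∑-distrib-+ N (λ q → indicator (Q? q (suc n))) (λ q → count (Q? q) n))))
    where
    newest : indicator (P? (suc n)) ≤ ∑ N (λ q → indicator (Q? q (suc n)))
    newest with P? (suc n)
    ... | no  _  = z≤n
    ... | yes Px with cover (suc n) (s≤s z≤n) ≤-refl Px
    ...   | q , 1≤q , q≤N , Qqx =
      ≤-trans (indicator-yes (Q? q (suc n)) Qqx) (term≤∑ N (λ q → indicator (Q? q (suc n))) 1≤q q≤N)

  module _ {q e : ℕ} (e≤q : e ≤ q) (e≤ : ∀ u → 1 ≤ u → P u → e ≤ u)
           (spaced : ∀ u v → u < v → P u → P v → u + q ≤ v) where

    private
      -- L is the largest element of P in [1, n].
      Invariant : ℕ → Set
      Invariant n = count P? n ≡ 0 ⊎ ∃[ L ] L ≤ n × P L × q * count P? n + e ≤ L + q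

      invariant : ∀ n → Invariant n
      invariant zero = inj₁ refl
      invariant (suc n) with P? (suc n) | invariant n
      ... | no  _  | inj₁ none                 = inj₁ none
      ... | no  _  | inj₂ (L , L≤n , PL , bound) = inj₂ (L , m≤n⇒m≤1+n L≤n , PL , bound)
      ... | yes Pn | inj₁ none = inj₂ (suc n , ≤-refl , Pn , (begin
            q * suc (count P? n) + e ≡⟨ cong (λ c → q * suc c + e) none ⟩
            q * 1 + e                ≡⟨ cong (_+ e) (*-identityʳ q) ⟩
            q + e                    ≤⟨ +-monoʳ-≤ q (e≤ (suc n) (s≤s z≤n) Pn) ⟩
            q + suc n                ≡⟨ +-comm q (suc n) ⟩
            suc n + q                ∎))
        where open ≤-Reasoning
      ... | yes Pn | inj₂ (L , L≤n , PL , bound) = inj₂ (suc n , ≤-refl , Pn , (begin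
            q * suc (count P? n) + e   ≡⟨ cong (_+ e) (*-suc q (count P? n)) ⟩
            q + q * count P? n + e     ≡⟨ +-assoc q (q * count P? n) e ⟩
            q + (q * count P? n + e)   ≤⟨ +-monoʳ-≤ q bound ⟩
            q + (L + q)                ≤⟨ +-monoʳ-≤ q (spaced L (suc n) (s≤s L≤n) PL Pn) ⟩
            q + suc n                  ≡⟨ +-comm q (suc n) ⟩
            suc n + q                  ∎))
        where open ≤-Reasoning

    spaced-count : ∀ n → q * count P? n + e ≤ n + q
    spaced-count n with invariant n
    ... | inj₁ none rewrite none | *-zeroʳ q = ≤-trans e≤q (m≤n+m q n)
    ... | inj₂ (L , L≤n , _ , bound)        = ≤-trans bound (+-monoˡ-≤ q L≤n)

module _ (w : ℕ → ℕ) (M : ℕ) (w₁≡0 : w 1 ≡ 0) where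

  private
    -- ∑ N w ≤ (3/4 − 1/N) M for N ≥ 2, which telescopes because 1/(N+1)² ≤ 1/N − 1/(N+1).
    telescoped : ∀ k → (∀ q → 2 ≤ q → q ≤ 2 + k → q * q * w q ≤ M) →
                 4 * (2 + k) * ∑ (2 + k) w + 4 * M ≤ 3 * (2 + k) * M
    telescoped zero    bound rewrite w₁≡0 | +-identityʳ (w 2) = begin
      8 * w 2 + 4 * M        ≡⟨ cong (_+ 4 * M) (*-assoc 2 4 (w 2)) ⟩
      2 * (4 * w 2) + 4 * M  ≤⟨ +-monoˡ-≤ (4 * M) (*-monoʳ-≤ 2 (bound 2 ≤-refl ≤-refl)) ⟩
      2 * M + 4 * M          ≡⟨ sym (*-distribʳ-+ M 2 4) ⟩
      6 * M                  ∎
      where open ≤-Reasoning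
    telescoped (suc k) bound = *-cancelˡ-≤ n (+-cancelʳ-≤ (4 * suc n * M) _ _ (begin
      n * (4 * suc n * (w (suc n) + S) + 4 * M) + 4 * suc n * M
        ≡⟨ expand n (w (suc n)) S M ⟩
      4 * (n * suc n * w (suc n)) + (suc n * (4 * n * S + 4 * M) + 4 * n * M)
        ≤⟨ +-mono-≤ (*-monoʳ-≤ 4 new-term) (+-monoˡ-≤ (4 * n * M) (*-monoʳ-≤ (suc n) previous)) ⟩
      4 * M + (suc n * (3 * n * M) + 4 * n * M)
        ≡⟨ collect n M ⟩
      n * (3 * suc n * M) + 4 * suc n * M ∎))
      where
      open ≤-Reasoning
      n = 2 + k
      S = ∑ n w
      previous : 4 * n * S + 4 * M ≤ 3 * n * M
      previous = telescoped k (λ q 2≤q q≤n → bound q 2≤q (m≤n⇒m≤1+n q≤n))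
      new-term : n * suc n * w (suc n) ≤ M
      new-term = ≤-trans (*-monoˡ-≤ (w (suc n)) (*-monoˡ-≤ (suc n) (n≤1+n n)))
                         (bound (suc n) (s≤s (s≤s z≤n)) ≤-refl)
      expand : ∀ N w S M → N * (4 * suc N * (w + S) + 4 * M) + 4 * suc N * M
                           ≡ 4 * (N * suc N * w) + (suc N * (4 * N * S + 4 * M) + 4 * N * M)
      expand = solve-∀
      collect : ∀ N M → 4 * M + (suc N * (3 * N * M) + 4 * N * M) ≡ N * (3 * suc N * M) + 4 * suc N * M
      collect = solve-∀

  ∑-inverse-square-bound : ∀ N → (∀ q → 2 ≤ q → q ≤ N → q * q * w q ≤ M) → 4 * ∑ N w ≤ 3 * M
  ∑-inverse-square-bound zero            bound = z≤n
  ∑-inverse-square-bound (suc zero)      bound rewrite w₁≡0 = z≤n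
  ∑-inverse-square-bound N@(suc (suc k)) bound = *-cancelˡ-≤ N (begin
    N * (4 * ∑ N w)        ≡⟨ regroup N (∑ N w) ⟩
    4 * N * ∑ N w          ≤⟨ m≤m+n _ (4 * M) ⟩
    4 * N * ∑ N w + 4 * M  ≤⟨ telescoped k bound ⟩
    3 * N * M              ≡⟨ cong (_* M) (*-comm 3 N) ⟩
    N * 3 * M              ≡⟨ *-assoc N 3 M ⟩
    N * (3 * M)            ∎)
    where
    open ≤-Reasoning
    regroup : ∀ N S → N * (4 * S) ≡ 4 * N * S
    regroup = solve-∀

-- Coprime pairs along an arithmetic progression

m<n∧o∣n∸m⇒m+o≤n : ∀ {m n o} → m < n → o ∣ n ∸ m → m + o ≤ n
m<n∧o∣n∸m⇒m+o≤n {m} {n} {o} m<n o∣n∸m = begin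
  m + o       ≤⟨ +-monoʳ-≤ m (∣⇒≤ ⦃ >-nonZero (m<n⇒0<n∸m m<n) ⦄ o∣n∸m) ⟩
  m + (n ∸ m) ≡⟨ m+[n∸m]≡n (<⇒≤ m<n) ⟩
  n           ∎
  where open ≤-Reasoning

¬coprime⇒2≤gcd : ∀ {m n} → 1 ≤ m → ¬ Coprime m n → 2 ≤ gcd m n
¬coprime⇒2≤gcd {m} {n} 1≤m ¬m⊥n with gcd m n in eq
... | zero        = ⊥-elim (<⇒≱ 1≤m (≤-reflexive (gcd[m,n]≡0⇒m≡0 eq)))
... | suc zero    = ⊥-elim (¬m⊥n (gcd≡1⇒coprime eq))
... | suc (suc _) = s≤s (s≤s z≤n)

+m-+n≡+[m∸n] : ∀ {m n} → n ≤ m → + m ℤ.- + n ≡ + (m ∸ n)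
+m-+n≡+[m∸n] {m} {n} n≤m = trans (ℤ.m-n≡m⊖n m n) (ℤ.⊖-≥ n≤m)

∣-abs⇒∣ : ∀ {q} (z : ℤ) → q ∣ ∣ z ∣ → + q ℤ.∣ z
∣-abs⇒∣ z = ℤ.∣ᵤ⇒∣

progression : ℤ → ℕ → ℕ → ℤ
progression s t x = s ℤ.+ + t ℤ.* + x

module _ (A Y t : ℕ) (s : ℤ) (s⊥t : Coprime ∣ s ∣ t) (8Y≤A : 8 * Y ≤ A) where

  private
    D : ℕ → ℤ
    D = progression s t

    divisor-coprime-to-t : ∀ q x → q ∣ ∣ D x ∣ → Coprime q t
    divisor-coprime-to-t q x q∣Dx {d} (d∣q , d∣t) = s⊥t (ℤ.∣⇒∣ᵤ d∣s , d∣t)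
      where
      d∣s : + d ℤ.∣ s
      d∣s = ℤ.∣m+n∣n⇒∣m (∣-abs⇒∣ (D x) (∣-trans d∣q q∣Dx)) (ℤ.∣m⇒∣m*n (+ x) (∣-abs⇒∣ (+ t) d∣t))

    D-difference : ∀ u v → u ≤ v → D v ℤ.- D u ≡ + (t * (v ∸ u))
    D-difference u v u≤v = begin
      D v ℤ.- D u             ≡⟨ identity s (+ t) (+ u) (+ v) ⟩
      + t ℤ.* (+ v ℤ.- + u)   ≡⟨ cong (+ t ℤ.*_) (+m-+n≡+[m∸n] u≤v) ⟩
      + t ℤ.* + (v ∸ u)       ≡⟨ ℤ.pos-* t (v ∸ u) ⟨
      + (t * (v ∸ u))         ∎
      where
      open ≡-Reasoning
      identity : ∀ s t u v → (s ℤ.+ t ℤ.* v) ℤ.- (s ℤ.+ t ℤ.* u) ≡ t ℤ.* (v ℤ.- u)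
      identity = ℤ-Solver.solve-∀

    divisor-spacing : ∀ q u v → u < v → q ∣ ∣ D u ∣ → q ∣ ∣ D v ∣ → u + q ≤ v
    divisor-spacing q u v u<v q∣Du q∣Dv = m<n∧o∣n∸m⇒m+o≤n u<v
      (coprime-divisor (divisor-coprime-to-t q u q∣Du) q∣t[v∸u])
      where
      q∣t[v∸u] : q ∣ t * (v ∸ u)
      q∣t[v∸u] = ℤ.∣⇒∣ᵤ (subst (+ q ℤ.∣_) (D-difference u v (<⇒≤ u<v))
                   (ℤ.∣m∣n⇒∣m-n (∣-abs⇒∣ (D v) q∣Dv) (∣-abs⇒∣ (D u) q∣Du)))

    multiple? : ∀ q → Decidable (λ y → 2 ≤ q × q ∣ y)
    multiple? q y = (2 ≤? q) ×-dec (q ∣? y)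

    divides-D? : ∀ q → Decidable (λ x → q ∣ ∣ D x ∣)
    divides-D? q x = q ∣? ∣ D x ∣

    coprime-D? : ∀ y → Decidable (λ x → Coprime y ∣ D x ∣)
    coprime-D? y x = coprime? y ∣ D x ∣

    c m : ℕ → ℕ
    c q = count (divides-D? q) A
    m q = count (multiple? q) Y

    q*c≤A+q : ∀ q → 1 ≤ q → q * c q + 1 ≤ A + q
    q*c≤A+q q 1≤q = spaced-count (divides-D? q) 1≤q (λ u 1≤u _ → 1≤u) (divisor-spacing q) A

    q*m≤Y : ∀ q → 2 ≤ q → q * m q ≤ Y
    q*m≤Y q 2≤q = +-cancelʳ-≤ q _ _ (spaced-count (multiple? q) ≤-refl q≤ spaced Y)
      where
      q≤ : ∀ u → 1 ≤ u → 2 ≤ q × q ∣ u → q ≤ u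
      q≤ (suc u) _ (_ , q∣u) = ∣⇒≤ q∣u
      spaced : ∀ u v → u < v → 2 ≤ q × q ∣ u → 2 ≤ q × q ∣ v → u + q ≤ v
      spaced u v u<v (_ , q∣u) (_ , q∣v) = m<n∧o∣n∸m⇒m+o≤n u<v
        (∣m+n∣m⇒∣n (subst (q ∣_) (sym (m+[n∸m]≡n (<⇒≤ u<v))) q∣v) q∣u)

    non-coprime-count : ∀ y → 1 ≤ y → y ≤ Y →
      count (λ x → ¬? (coprime-D? y x)) A ≤ ∑ Y (λ q → indicator (multiple? q y) * c q)
    non-coprime-count y 1≤y y≤Y = begin
      count (λ x → ¬? (coprime-D? y x)) A
        ≤⟨ count≤∑count (λ x → ¬? (coprime-D? y x)) (λ q x → multiple? q y ×-dec divides-D? q x)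
                        Y A common-factor ⟩
      ∑ Y (λ q → count (λ x → multiple? q y ×-dec divides-D? q x) A)
        ≡⟨ ∑-cong Y (λ q → count-×-const (divides-D? q) (multiple? q y) A) ⟩
      ∑ Y (λ q → indicator (multiple? q y) * c q) ∎
      where
      open ≤-Reasoning
      common-factor : ∀ x → 1 ≤ x → x ≤ A → ¬ Coprime y ∣ D x ∣ →
                      ∃[ q ] 1 ≤ q × q ≤ Y × ((2 ≤ q × q ∣ y) × q ∣ ∣ D x ∣)
      common-factor x _ _ ¬y⊥Dx =
        gcd y ∣ D x ∣ , ≤-trans (s≤s z≤n) 2≤g ,
        ≤-trans (∣⇒≤ ⦃ >-nonZero 1≤y ⦄ (gcd[m,n]∣m y ∣ D x ∣)) y≤Y ,
        (2≤g , gcd[m,n]∣m y ∣ D x ∣) , gcd[m,n]∣n y ∣ D x ∣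
        where
        2≤g : 2 ≤ gcd y ∣ D x ∣
        2≤g = ¬coprime⇒2≤gcd 1≤y ¬y⊥Dx

    non-coprime-pairs : ∑ Y (λ y → count (λ x → ¬? (coprime-D? y x)) A) ≤ ∑ Y (λ q → c q * m q)
    non-coprime-pairs = begin
      ∑ Y (λ y → count (λ x → ¬? (coprime-D? y x)) A)  ≤⟨ ∑-mono-≤ Y non-coprime-count ⟩
      ∑ Y (λ y → ∑ Y (λ q → indicator (multiple? q y) * c q))
        ≡⟨ ∑-comm Y Y (λ y q → indicator (multiple? q y) * c q) ⟩
      ∑ Y (λ q → ∑ Y (λ y → indicator (multiple? q y) * c q))
        ≡⟨ ∑-cong Y (λ q → trans (∑-cong Y (λ y → *-comm (indicator (multiple? q y)) (c q)))
                                   (*-distribˡ-∑ Y (c q) (λ y → indicator (multiple? q y)))) ⟩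
      ∑ Y (λ q → c q * m q)                            ∎
      where open ≤-Reasoning

    weight-bound : ∀ q → 2 ≤ q → q ≤ Y → q * q * (8 * (c q * m q)) ≤ 9 * A * Y
    weight-bound q 2≤q q≤Y = begin
      q * q * (8 * (c q * m q))  ≡⟨ rearrange q (c q) (m q) ⟩
      8 * ((q * c q) * (q * m q)) ≤⟨ *-monoʳ-≤ 8 (*-mono-≤ q*c≤A+q′ (q*m≤Y q 2≤q)) ⟩
      8 * ((A + q) * Y)          ≡⟨ distribute A q Y ⟩
      (8 * A + 8 * q) * Y        ≤⟨ *-monoˡ-≤ Y (+-monoʳ-≤ (8 * A) (≤-trans (*-monoʳ-≤ 8 q≤Y) 8Y≤A)) ⟩
      (8 * A + A) * Y            ≡⟨ collect A Y ⟩
      9 * A * Y                  ∎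
      where
      open ≤-Reasoning
      q*c≤A+q′ : q * c q ≤ A + q
      q*c≤A+q′ = ≤-trans (m≤m+n _ 1) (q*c≤A+q q (≤-trans (s≤s z≤n) 2≤q))
      rearrange : ∀ q c m → q * q * (8 * (c * m)) ≡ 8 * ((q * c) * (q * m))
      rearrange = solve-∀
      distribute : ∀ A q Y → 8 * ((A + q) * Y) ≡ (8 * A + 8 * q) * Y
      distribute = solve-∀
      collect : ∀ A Y → (8 * A + A) * Y ≡ 9 * A * Y
      collect = solve-∀

  coprime-sieve : 5 * (A * Y) ≤ 32 * ∑ Y (λ y → count (λ x → coprime? y ∣ progression s t x ∣) A)
  coprime-sieve = +-cancelʳ-≤ (27 * (A * Y)) _ _ (begin
    5 * (A * Y) + 27 * (A * Y)  ≡⟨ sym (*-distribʳ-+ (A * Y) 5 27) ⟩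
    32 * (A * Y)                ≡⟨ cong (32 *_) (sym all-pairs) ⟩
    32 * (#coprime + #non-coprime)       ≡⟨ *-distribˡ-+ 32 #coprime #non-coprime ⟩
    32 * #coprime + 32 * #non-coprime   ≤⟨ +-monoʳ-≤ (32 * #coprime) 32*#non-coprime≤ ⟩
    32 * #coprime + 27 * (A * Y)        ∎)
    where
    open ≤-Reasoning
    #coprime #non-coprime : ℕ
    #coprime     = ∑ Y (λ y → count (coprime-D? y) A)
    #non-coprime = ∑ Y (λ y → count (λ x → ¬? (coprime-D? y x)) A)
    all-pairs : #coprime + #non-coprime ≡ A * Y
    all-pairs = begin-equality
      #coprime + #non-coprime ≡⟨ ∑-distrib-+ Y _ _ ⟨
      ∑ Y (λ y → count (coprime-D? y) A + count (λ x → ¬? (coprime-D? y x)) A)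
                   ≡⟨ ∑-cong Y (λ y → count-complement (coprime-D? y) A) ⟩
      ∑ Y (λ _ → A) ≡⟨ ∑-const Y A ⟩
      Y * A        ≡⟨ *-comm Y A ⟩
      A * Y        ∎
    32*#non-coprime≤ : 32 * #non-coprime ≤ 27 * (A * Y)
    32*#non-coprime≤ = begin
      32 * #non-coprime                   ≤⟨ *-monoʳ-≤ 32 non-coprime-pairs ⟩
      32 * ∑ Y (λ q → c q * m q)          ≡⟨ *-assoc 4 8 (∑ Y (λ q → c q * m q)) ⟩
      4 * (8 * ∑ Y (λ q → c q * m q))     ≡⟨ cong (4 *_) (*-distribˡ-∑ Y 8 (λ q → c q * m q)) ⟨
      4 * ∑ Y (λ q → 8 * (c q * m q))     ≤⟨ ∑-inverse-square-bound _ (9 * A * Y) c₁*m₁≡0 Y weight-bound ⟩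
      3 * (9 * A * Y)                     ≡⟨ regroup A Y ⟩
      27 * (A * Y)                        ∎
      where
      c₁*m₁≡0 : 8 * (c 1 * m 1) ≡ 0
      c₁*m₁≡0 rewrite count-none (multiple? 1) (λ _ (2≤1 , _) → <⇒≱ 2≤1 (s≤s z≤n)) Y | *-zeroʳ (c 1) = refl
      regroup : ∀ A Y → 3 * (9 * A * Y) ≡ 27 * (A * Y)
      regroup = solve-∀

infix 4 _≡_mod_
-- A record rather than a synonym for divisibility, so that i and j can be inferred.
record _≡_mod_ (i j : ℤ) (n : ℕ) : Set where
  constructor from-∣
  field to-∣ : + n ℤ.∣ i ℤ.- j
open _≡_mod_

module _ {n : ℕ} where

  ≡-mod-refl : ∀ {i} → i ≡ i mod n
  ≡-mod-refl {i} = from-∣ (subst (+ n ℤ.∣_) (sym (ℤ.+-inverseʳ i)) (ℤ.divides ℤ.0ℤ refl))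

  ≡-mod-sym : ∀ {i j} → i ≡ j mod n → j ≡ i mod n
  ≡-mod-sym {i} {j} (from-∣ n∣i-j) = from-∣ (subst (+ n ℤ.∣_) (identity i j) (ℤ.∣m⇒∣-m n∣i-j))
    where
    identity : ∀ i j → ℤ.- (i ℤ.- j) ≡ j ℤ.- i
    identity = ℤ-Solver.solve-∀

  ≡-mod-trans : ∀ {i j k} → i ≡ j mod n → j ≡ k mod n → i ≡ k mod n
  ≡-mod-trans {i} {j} {k} (from-∣ n∣i-j) (from-∣ n∣j-k) =
    from-∣ (subst (+ n ℤ.∣_) (identity i j k) (ℤ.∣m∣n⇒∣m+n n∣i-j n∣j-k))
    where
    identity : ∀ i j k → (i ℤ.- j) ℤ.+ (j ℤ.- k) ≡ i ℤ.- k
    identity = ℤ-Solver.solve-∀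

  -‿cong-mod : ∀ {i j k l} → i ≡ j mod n → k ≡ l mod n → i ℤ.- k ≡ j ℤ.- l mod n
  -‿cong-mod {i} {j} {k} {l} (from-∣ n∣i-j) (from-∣ n∣k-l) =
    from-∣ (subst (+ n ℤ.∣_) (identity i j k l) (ℤ.∣m∣n⇒∣m-n n∣i-j n∣k-l))
    where
    identity : ∀ i j k l → (i ℤ.- j) ℤ.- (k ℤ.- l) ≡ (i ℤ.- k) ℤ.- (j ℤ.- l)
    identity = ℤ-Solver.solve-∀

  *-cong-mod : ∀ {i j k l} → i ≡ j mod n → k ≡ l mod n → i ℤ.* k ≡ j ℤ.* l mod n
  *-cong-mod {i} {j} {k} {l} (from-∣ n∣i-j) (from-∣ n∣k-l) =
    from-∣ (subst (+ n ℤ.∣_) (identity i j k l) (ℤ.∣m∣n⇒∣m+n (ℤ.∣m⇒∣m*n k n∣i-j) (ℤ.∣n⇒∣m*n j n∣k-l)))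
    where
    identity : ∀ i j k l → (i ℤ.- j) ℤ.* k ℤ.+ j ℤ.* (k ℤ.- l) ≡ i ℤ.* k ℤ.- j ℤ.* l
    identity = ℤ-Solver.solve-∀

  ≡-mod-setoid : Setoid 0ℓ 0ℓ
  ≡-mod-setoid = record
    { Carrier = ℤ
    ; _≈_ = λ i j → i ≡ j mod n
    ; isEquivalence = record { refl = ≡-mod-refl ; sym = ≡-mod-sym ; trans = ≡-mod-trans }
    }

  n∣i∧∣i∣<n⇒i≡0 : ∀ {z} → + n ℤ.∣ z → ∣ z ∣ < n → z ≡ ℤ.0ℤ
  n∣i∧∣i∣<n⇒i≡0 {z} n∣z ∣z∣<n with ∣ z ∣ in ∣z∣≡ | ℤ.∣⇒∣ᵤ n∣z
  ... | zero  | _     = ℤ.∣i∣≡0⇒i≡0 ∣z∣≡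
  ... | suc _ | n∣∣z∣ = ⊥-elim (<⇒≱ ∣z∣<n (∣⇒≤ n∣∣z∣))

module ≡-mod-Reasoning (n : ℕ) = SetoidReasoning (≡-mod-setoid {n})

bézout-coefficient : ∀ {d m n} → Bézout.Identity d m n → ℤ
bézout-coefficient (Bézout.+- x _ _) = + x
bézout-coefficient (Bézout.-+ x _ _) = ℤ.- + x

bézout-≡-mod : ∀ {d m n} (b : Bézout.Identity d m n) → bézout-coefficient b ℤ.* + m ≡ + d mod n
bézout-≡-mod {d} {m} {n} (Bézout.+- x y d+yn≡xm) = from-∣ (subst (+ n ℤ.∣_) (sym (begin
  + x ℤ.* + m ℤ.- + d       ≡⟨ cong (ℤ._- + d) (ℤ.pos-* x m) ⟨
  + (x * m) ℤ.- + d         ≡⟨ cong (λ k → + k ℤ.- + d) d+yn≡xm ⟨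
  + (d + y * n) ℤ.- + d     ≡⟨ cong (ℤ._- + d) (ℤ.pos-+ d (y * n)) ⟩
  + d ℤ.+ + (y * n) ℤ.- + d ≡⟨ identity (+ d) (+ (y * n)) ⟩
  + (y * n)                 ≡⟨ ℤ.pos-* y n ⟩
  + y ℤ.* + n               ∎)) (ℤ.∣n⇒∣m*n (+ y) ℤ.∣-refl))
  where
  open ≡-Reasoning
  identity : ∀ d k → d ℤ.+ k ℤ.- d ≡ k
  identity = ℤ-Solver.solve-∀
bézout-≡-mod {d} {m} {n} (Bézout.-+ x y d+xm≡yn) = from-∣ (subst (+ n ℤ.∣_) (sym (begin
  ℤ.- + x ℤ.* + m ℤ.- + d       ≡⟨ identity (+ x) (+ m) (+ d) ⟩
  ℤ.- (+ d ℤ.+ + x ℤ.* + m)     ≡⟨ cong (λ k → ℤ.- (+ d ℤ.+ k)) (ℤ.pos-* x m) ⟨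
  ℤ.- (+ d ℤ.+ + (x * m))       ≡⟨ cong ℤ.-_ (ℤ.pos-+ d (x * m)) ⟨
  ℤ.- + (d + x * m)             ≡⟨ cong (λ k → ℤ.- + k) d+xm≡yn ⟩
  ℤ.- + (y * n)                 ≡⟨ cong ℤ.-_ (ℤ.pos-* y n) ⟩
  ℤ.- (+ y ℤ.* + n)             ∎)) (ℤ.∣m⇒∣-m (ℤ.∣n⇒∣m*n (+ y) ℤ.∣-refl)))
  where
  open ≡-Reasoning
  identity : ∀ x m d → ℤ.- x ℤ.* m ℤ.- d ≡ ℤ.- (d ℤ.+ x ℤ.* m)
  identity = ℤ-Solver.solve-∀

n≤m∧p∣m∸n⇒m%p≡n%p : ∀ {m n p} .⦃ _ : NonZero p ⦄ → n ≤ m → p ∣ m ∸ n → m % p ≡ n % p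
n≤m∧p∣m∸n⇒m%p≡n%p {m} {n} {p} n≤m (divides k m∸n≡kp) = begin
  m % p             ≡⟨ cong (_% p) (m+[n∸m]≡n n≤m) ⟨
  (n + (m ∸ n)) % p ≡⟨ cong (λ d → (n + d) % p) m∸n≡kp ⟩
  (n + k * p) % p   ≡⟨ [m+kn]%n≡m%n n k p ⟩
  n % p             ∎
  where open ≡-Reasoning

module _ (p : ℕ) .⦃ _ : NonZero p ⦄ where

  ≡-mod⇒%≡ : ∀ {m n} → + m ≡ + n mod p → m % p ≡ n % p
  ≡-mod⇒%≡ {m} {n} m≡n with ≤-total n m
  ... | inj₁ n≤m = n≤m∧p∣m∸n⇒m%p≡n%p n≤m (ℤ.∣⇒∣ᵤ (subst (+ p ℤ.∣_) (+m-+n≡+[m∸n] n≤m) (to-∣ m≡n)))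
  ... | inj₂ m≤n =
    sym (n≤m∧p∣m∸n⇒m%p≡n%p m≤n (ℤ.∣⇒∣ᵤ (subst (+ p ℤ.∣_) (+m-+n≡+[m∸n] m≤n) (to-∣ (≡-mod-sym m≡n)))))

  %ℕ-≡-mod : ∀ z → + (z ℤ.%ℕ p) ≡ z mod p
  %ℕ-≡-mod z = from-∣ (subst (+ p ℤ.∣_) (sym (begin
    + r ℤ.- z                       ≡⟨ cong (ℤ._-_ (+ r)) (ℤ.a≡a%ℕn+[a/ℕn]*n z p) ⟩
    + r ℤ.- (+ r ℤ.+ q ℤ.* + p)     ≡⟨ identity (+ r) q (+ p) ⟩
    ℤ.- (q ℤ.* + p)                 ∎)) (ℤ.∣m⇒∣-m (ℤ.∣n⇒∣m*n q ℤ.∣-refl)))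
    where
    open ≡-Reasoning
    r = z ℤ.%ℕ p
    q = z ℤ./ℕ p
    identity : ∀ r q p → r ℤ.- (r ℤ.+ q ℤ.* p) ≡ ℤ.- (q ℤ.* p)
    identity = ℤ-Solver.solve-∀

  residue : ℤ → Fin p
  residue z = fromℕ< (ℤ.n%ℕd<d z p)

  residue-≡-mod : ∀ z → + toℕ (residue z) ≡ z mod p
  residue-≡-mod z rewrite toℕ-fromℕ< (ℤ.n%ℕd<d z p) = %ℕ-≡-mod z

  -- A Bézout coefficient of n against p, which is an inverse of n modulo p when gcd n p = 1.
  inverse : ℕ → ℤ
  inverse n with Bézout.lemma n p
  ... | Bézout.result _ _ b = bézout-coefficient b

  inverse-≡-mod : Prime p → ∀ {n} → 1 ≤ n → n < p → inverse n ℤ.* + n ≡ ℤ.1ℤ mod p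
  inverse-≡-mod pp {n} 1≤n n<p with Bézout.lemma n p
  ... | Bézout.result d g b with GCD.unique g (coprime⇒GCD≡1 n⊥p)
    where
    n⊥p : Coprime n p
    n⊥p = coprime-sym (prime⇒coprime pp ⦃ >-nonZero 1≤n ⦄ n<p)
  ...   | refl = bézout-≡-mod b

-- Dirichlet approximation modulo a prime

m*o/p≡n*o/p⇒[m∸n]*o<p : ∀ m n o {p} .⦃ _ : NonZero p ⦄ → m * o / p ≡ n * o / p → (m ∸ n) * o < p
m*o/p≡n*o/p⇒[m∸n]*o<p m n o {p} same = begin-strict
  (m ∸ n) * o                               ≡⟨ *-distribʳ-∸ o m n ⟩
  m * o ∸ n * o                             ≡⟨ cong₂ _∸_ (split m refl) (split n (sym same)) ⟩
  (k * p + m * o % p) ∸ (k * p + n * o % p) ≡⟨ [m+n]∸[m+o]≡n∸o (k * p) _ _ ⟩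
  m * o % p ∸ n * o % p                     ≤⟨ m∸n≤m (m * o % p) (n * o % p) ⟩
  m * o % p                                 <⟨ m%n<n (m * o) p ⟩
  p                                         ∎
  where
  open ≤-Reasoning
  k = m * o / p
  split : ∀ x → x * o / p ≡ k → x * o ≡ k * p + x * o % p
  split x x*o/p≡k = trans (m≡m%n+[m/n]*n (x * o) p)
                          (trans (+-comm (x * o % p) _) (cong (λ q → q * p + x * o % p) x*o/p≡k))

m*o/p≡n*o/p⇒∣m-n∣*o<p : ∀ m n o {p} .⦃ _ : NonZero p ⦄ → m * o / p ≡ n * o / p → ∣ + m ℤ.- + n ∣ * o < p
m*o/p≡n*o/p⇒∣m-n∣*o<p m n o {p} same with ≤-total n m
... | inj₁ n≤m =
  subst (λ d → d * o < p) (sym (cong ∣_∣ (+m-+n≡+[m∸n] n≤m))) (m*o/p≡n*o/p⇒[m∸n]*o<p m n o same)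
... | inj₂ m≤n =
  subst (λ d → d * o < p) (sym ∣m-n∣≡n∸m) (m*o/p≡n*o/p⇒[m∸n]*o<p n m o (sym same))
  where
  ∣m-n∣≡n∸m : ∣ + m ℤ.- + n ∣ ≡ n ∸ m
  ∣m-n∣≡n∸m = trans (cong ∣_∣ (ℤ.m-n≡m⊖n m n)) (ℤ.∣⊖∣-≤ m≤n)

record DirichletApproximation (p a T : ℕ) : Set where
  field
    t       : ℕ
    s       : ℤ
    1≤t     : 1 ≤ t
    t≤T     : t ≤ T
    ∣s∣*T<p : ∣ s ∣ * T < p
    s≡at    : s ≡ + a ℤ.* + t mod p
    s⊥t     : Coprime ∣ s ∣ t

prime∣m*n∧n<p⇒∣m : ∀ {p m n} .⦃ _ : NonZero n ⦄ → Prime p → n < p → p ∣ m * n → p ∣ m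
prime∣m*n∧n<p⇒∣m {p} {m} {n} pp n<p p∣mn with euclidsLemma m n pp p∣mn
... | inj₁ p∣m = p∣m
... | inj₂ p∣n = ⊥-elim (<⇒≱ n<p (∣⇒≤ p∣n))

module _ {p : ℕ} (pp : Prime p) {a T : ℕ} (T<p : T < p) where

  private instance
    p≢0 : NonZero p
    p≢0 = prime⇒nonZero pp

  lowest-terms : ∀ t (s : ℤ) → 1 ≤ t → t ≤ T → ∣ s ∣ * T < p → s ≡ + a ℤ.* + t mod p →
                 DirichletApproximation p a T
  lowest-terms t s 1≤t t≤T ∣s∣*T<p s≡at = record
    { t       = t / g
    ; s       = s′
    ; 1≤t     = m≥n⇒m/n>0 (∣⇒≤ ⦃ >-nonZero 1≤t ⦄ g∣t)
    ; t≤T     = ≤-trans (m/n≤m t g) t≤T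
    ; ∣s∣*T<p = ≤-<-trans (*-monoˡ-≤ T ∣s′∣≤∣s∣) ∣s∣*T<p
    ; s≡at    = from-∣ (∣-abs⇒∣ _ (prime∣m*n∧n<p⇒∣m pp g<p p∣[s′-at′]*g))
    ; s⊥t     = subst (λ k → Coprime k (t / g)) (sym ∣s′∣≡∣s∣/g) (coprime-/gcd ∣ s ∣ t)
    }
    where
    g = gcd ∣ s ∣ t
    instance
      g≢0 : NonZero g
      g≢0 = ≢-nonZero (gcd[m,n]≢0 ∣ s ∣ t (inj₂ (λ t≡0 → <⇒≱ 1≤t (≤-reflexive t≡0))))
    g∣t : g ∣ t
    g∣t = gcd[m,n]∣n ∣ s ∣ t
    g∣s : + g ℤ.∣ s
    g∣s = ∣-abs⇒∣ s (gcd[m,n]∣m ∣ s ∣ t)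
    s′ : ℤ
    s′ = ℤ.quotient g∣s
    ∣s∣≡∣s′∣*g : ∣ s ∣ ≡ ∣ s′ ∣ * g
    ∣s∣≡∣s′∣*g = trans (cong ∣_∣ (ℤ._∣_.equality g∣s)) (ℤ.abs-* s′ (+ g))
    ∣s′∣≡∣s∣/g : ∣ s′ ∣ ≡ ∣ s ∣ / g
    ∣s′∣≡∣s∣/g = sym (trans (cong (_/ g) ∣s∣≡∣s′∣*g) (m*n/n≡m ∣ s′ ∣ g))
    ∣s′∣≤∣s∣ : ∣ s′ ∣ ≤ ∣ s ∣
    ∣s′∣≤∣s∣ = subst (∣ s′ ∣ ≤_) (sym ∣s∣≡∣s′∣*g) (m≤m*n ∣ s′ ∣ g)
    scale : (s′ ℤ.- + a ℤ.* + (t / g)) ℤ.* + g ≡ s ℤ.- + a ℤ.* + t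
    scale = begin
      (s′ ℤ.- + a ℤ.* + (t / g)) ℤ.* + g         ≡⟨ identity s′ (+ a) (+ (t / g)) (+ g) ⟩
      s′ ℤ.* + g ℤ.- + a ℤ.* (+ (t / g) ℤ.* + g) ≡⟨ cong₂ (λ u v → u ℤ.- + a ℤ.* v) (sym (ℤ._∣_.equality g∣s))
                                                      (trans (sym (ℤ.pos-* (t / g) g)) (cong +_ (m/n*n≡m g∣t))) ⟩
      s ℤ.- + a ℤ.* + t                          ∎
      where
      open ≡-Reasoning
      identity : ∀ s a t g → (s ℤ.- a ℤ.* t) ℤ.* g ≡ s ℤ.* g ℤ.- a ℤ.* (t ℤ.* g)
      identity = ℤ-Solver.solve-∀
    p∣[s′-at′]*g : p ∣ ∣ s′ ℤ.- + a ℤ.* + (t / g) ∣ * g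
    p∣[s′-at′]*g = subst (p ∣_) (trans (cong ∣_∣ (sym scale)) (ℤ.abs-* (s′ ℤ.- + a ℤ.* + (t / g)) (+ g)))
                         (ℤ.∣⇒∣ᵤ (to-∣ s≡at))
    g<p : g < p
    g<p = ≤-<-trans (∣⇒≤ ⦃ >-nonZero 1≤t ⦄ g∣t) (≤-<-trans t≤T T<p)

  private
    ρ : ℕ → ℕ
    ρ u = a * u % p

    bucket : 1 ≤ T → Fin (suc T) → Fin T
    bucket 1≤T i = fromℕ< {m = ρ (toℕ i) * T / p} (m<n*o⇒m/o<n (begin-strict
      ρ (toℕ i) * T ≡⟨ *-comm (ρ (toℕ i)) T ⟩
      T * ρ (toℕ i) <⟨ *-monoʳ-< T ⦃ >-nonZero 1≤T ⦄ (m%n<n (a * toℕ i) p) ⟩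
      T * p         ∎))
      where open ≤-Reasoning

  -- Two of the T + 1 residues a u mod p with u ≤ T fall into the same of T intervals of length p / T.
  dirichlet : 1 ≤ T → DirichletApproximation p a T
  dirichlet 1≤T with pigeonhole (n<1+n T) (bucket 1≤T)
  ... | i , j , i<j , same-bucket =
    lowest-terms t (+ ρ v ℤ.- + ρ u) (m<n⇒0<n∸m i<j) t≤T ∣s∣*T<p s≡at
    where
    u v t : ℕ
    u = toℕ i
    v = toℕ j
    t = v ∸ u
    t≤T : t ≤ T
    t≤T = ≤-trans (m∸n≤m v u) (≤-pred (toℕ<n j))
    ∣s∣*T<p : ∣ + ρ v ℤ.- + ρ u ∣ * T < p
    ∣s∣*T<p = m*o/p≡n*o/p⇒∣m-n∣*o<p (ρ v) (ρ u) T
                (trans (sym (toℕ-fromℕ< _)) (trans (cong toℕ (sym same-bucket)) (toℕ-fromℕ< _)))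
    s≡at : + ρ v ℤ.- + ρ u ≡ + a ℤ.* + t mod p
    s≡at = begin
      + ρ v ℤ.- + ρ u         ≈⟨ -‿cong-mod (%ℕ-≡-mod p (+ (a * v))) (%ℕ-≡-mod p (+ (a * u))) ⟩
      + (a * v) ℤ.- + (a * u) ≡⟨ +m-+n≡+[m∸n] (*-monoʳ-≤ a (<⇒≤ i<j)) ⟩
      + (a * v ∸ a * u)       ≡⟨ cong +_ (*-distribˡ-∸ a v u) ⟨
      + (a * t)               ≡⟨ ℤ.pos-* a t ⟩
      + a ℤ.* + t             ∎
      where open ≡-mod-Reasoning p

unique∧⊆⇒length≤ : {A : Set} {xs ys : List A} → Unique xs → xs ⊆ ys → length xs ≤ length ys
unique∧⊆⇒length≤ {xs = []}     _            _     = z≤n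
unique∧⊆⇒length≤ {xs = x ∷ xs} (x∉xs ∷ xs!) xs⊆ys with ∈-∃++ (xs⊆ys (here refl))
... | ys₁ , ys₂ , refl = begin
  suc (length xs)           ≤⟨ s≤s (unique∧⊆⇒length≤ xs! xs⊆ys₁++ys₂) ⟩
  suc (length (ys₁ ++ ys₂)) ≡⟨ cong suc (length-++ ys₁) ⟩
  suc (length ys₁ + length ys₂) ≡⟨ +-suc (length ys₁) (length ys₂) ⟨
  length ys₁ + length (x ∷ ys₂) ≡⟨ length-++ ys₁ ⟨
  length (ys₁ ++ x ∷ ys₂)   ∎
  where
  open ≤-Reasoning
  xs⊆ys₁++ys₂ : xs ⊆ ys₁ ++ ys₂
  xs⊆ys₁++ys₂ z∈xs with ∈-++⁻ ys₁ (xs⊆ys (there z∈xs))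
  ... | inj₁ z∈ys₁         = ∈-++⁺ˡ z∈ys₁
  ... | inj₂ (here z≡x)    = ⊥-elim (All.lookup x∉xs z∈xs (sym z≡x))
  ... | inj₂ (there z∈ys₂) = ∈-++⁺ʳ ys₁ z∈ys₂

module _ {A : Set} {G : ℕ → Pred ℕ 0ℓ} (G? : ∀ y → Decidable (G y)) (f : ℕ → ℕ → A) (X Y : ℕ) where

  Good : ℕ → ℕ → Set
  Good x y = (1 ≤ x × x ≤ X) × (1 ≤ y × y ≤ Y) × G y x

  private
    row : ℕ → ℕ → List A
    row y zero    = []
    row y (suc x) with G? y (suc x)
    ... | yes _ = f (suc x) y ∷ row y x
    ... | no  _ = row y x

    image : ℕ → List A
    image zero    = []
    image (suc y) = row (suc y) X ++ image y

    length-row : ∀ y n → length (row y n) ≡ count (G? y) n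
    length-row y zero    = refl
    length-row y (suc n) with G? y (suc n)
    ... | yes _ = cong suc (length-row y n)
    ... | no  _ = length-row y n

    length-image : ∀ m → length (image m) ≡ ∑ m (λ y → count (G? y) X)
    length-image zero    = refl
    length-image (suc m) =
      trans (length-++ (row (suc m) X)) (cong₂ _+_ (length-row (suc m) X) (length-image m))

    ∈-row⁻ : ∀ {z} y n → z ∈ row y n → ∃[ x ] (1 ≤ x × x ≤ n) × G y x × z ≡ f x y
    ∈-row⁻ y (suc n) z∈row with G? y (suc n)
    ∈-row⁻ y (suc n) (here refl)   | yes Gyx = suc n , (s≤s z≤n , ≤-refl) , Gyx , refl
    ∈-row⁻ y (suc n) (there z∈row) | yes _ with ∈-row⁻ y n z∈row
    ... | x , (1≤x , x≤n) , Gyx , refl = x , (1≤x , m≤n⇒m≤1+n x≤n) , Gyx , refl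
    ∈-row⁻ y (suc n) z∈row         | no  _ with ∈-row⁻ y n z∈row
    ... | x , (1≤x , x≤n) , Gyx , refl = x , (1≤x , m≤n⇒m≤1+n x≤n) , Gyx , refl

    ∈-image⁻ : ∀ {z} m → z ∈ image m → ∃[ y ] (1 ≤ y × y ≤ m) × z ∈ row y X
    ∈-image⁻ (suc m) z∈image with ∈-++⁻ (row (suc m) X) z∈image
    ... | inj₁ z∈row = suc m , (s≤s z≤n , ≤-refl) , z∈row
    ... | inj₂ z∈image′ with ∈-image⁻ m z∈image′
    ...   | y , (1≤y , y≤m) , z∈row = y , (1≤y , m≤n⇒m≤1+n y≤m) , z∈row

  module _ (injective : ∀ {x₁ y₁ x₂ y₂} → Good x₁ y₁ → Good x₂ y₂ → f x₁ y₁ ≡ f x₂ y₂ →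
                        x₁ ≡ x₂ × y₁ ≡ y₂) where

    private
      unique-row : ∀ y n → 1 ≤ y → y ≤ Y → n ≤ X → Unique (row y n)
      unique-row y zero    _   _   _   = []
      unique-row y (suc n) 1≤y y≤Y n<X with G? y (suc n)
      ... | no  _   = unique-row y n 1≤y y≤Y (≤-trans (n≤1+n n) n<X)
      ... | yes Gyn = All.tabulate new ∷ unique-row y n 1≤y y≤Y (≤-trans (n≤1+n n) n<X)
        where
        new : ∀ {z} → z ∈ row y n → f (suc n) y ≢ z
        new z∈row eq with ∈-row⁻ y n z∈row
        ... | x , (1≤x , x≤n) , Gyx , refl =
          <⇒≱ (s≤s x≤n) (≤-reflexive (proj₁ (injective ((s≤s z≤n , n<X) , (1≤y , y≤Y) , Gyn)
                                                      ((1≤x , ≤-trans x≤n (≤-trans (n≤1+n n) n<X)) , (1≤y , y≤Y) , Gyx) eq)))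

      unique-image : ∀ m → m ≤ Y → Unique (image m)
      unique-image zero    _   = []
      unique-image (suc m) m<Y =
        Unique.++⁺ (unique-row (suc m) X (s≤s z≤n) m<Y ≤-refl)
                   (unique-image m (≤-trans (n≤1+n m) m<Y)) disjoint
        where
        disjoint : ∀ {z} → ¬ (z ∈ row (suc m) X × z ∈ image m)
        disjoint (z∈row , z∈image) with ∈-image⁻ m z∈image
        ... | y , (1≤y , y≤m) , z∈row′ with ∈-row⁻ (suc m) X z∈row | ∈-row⁻ y X z∈row′
        ...   | x₁ , x₁-range , Gx₁ , refl | x₂ , x₂-range , Gx₂ , eq =
          <⇒≱ (s≤s y≤m) (≤-reflexive (proj₂ (injective (x₁-range , (s≤s z≤n , m<Y) , Gx₁)
                                                      (x₂-range , (1≤y , ≤-trans (m≤n⇒m≤1+n y≤m) m<Y) , Gx₂) eq)))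

    ∑count≤length : (zs : List A) → (∀ {x y} → Good x y → f x y ∈ zs) →
                    ∑ Y (λ y → count (G? y) X) ≤ length zs
    ∑count≤length zs image⊆zs = begin
      ∑ Y (λ y → count (G? y) X) ≡⟨ length-image Y ⟨
      length (image Y)           ≤⟨ unique∧⊆⇒length≤ (unique-image Y ≤-refl) image-Y⊆zs ⟩
      length zs                  ∎
      where
      open ≤-Reasoning
      image-Y⊆zs : image Y ⊆ zs
      image-Y⊆zs z∈image with ∈-image⁻ Y z∈image
      ... | y , y-range , z∈row with ∈-row⁻ y X z∈row
      ...   | x , x-range , Gyx , refl = image⊆zs (x-range , y-range , Gyx)

∈-range : ∀ {x n} → 1 ≤ x → x ≤ n → x ∈ range n
∈-range {suc x} (s≤s _) x<n = ∈-map⁺ suc (∈-upTo⁺ x<n)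

coprime∧coprime∧cross-mul⇒≡ : ∀ {a b c d} → Coprime a b → Coprime c d → a * d ≡ c * b → a ≡ c
coprime∧coprime∧cross-mul⇒≡ {a} {b} {c} {d} a⊥b c⊥d ad≡cb = ∣-antisym
  (coprime-divisor a⊥b (divides d (trans (*-comm b c) (trans (sym ad≡cb) (*-comm a d)))))
  (coprime-divisor c⊥d (divides b (trans (*-comm d a) (trans ad≡cb (*-comm c b)))))

module _ {p : ℕ} (pp : Prime p) where

  private instance
    p≢0 : NonZero p
    p≢0 = prime⇒nonZero pp

  quotient : ℕ → ℕ → Fin p
  quotient y n = residue p (+ y ℤ.* inverse p n)

  quotient-≡-mod : ∀ y {n} → 1 ≤ n → n < p → + toℕ (quotient y n) ℤ.* + n ≡ + y mod p
  quotient-≡-mod y {n} 1≤n n<p = begin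
    + toℕ (quotient y n) ℤ.* + n    ≈⟨ *-cong-mod (residue-≡-mod p (+ y ℤ.* inverse p n)) ≡-mod-refl ⟩
    + y ℤ.* inverse p n ℤ.* + n     ≡⟨ ℤ.*-assoc (+ y) (inverse p n) (+ n) ⟩
    + y ℤ.* (inverse p n ℤ.* + n)   ≈⟨ *-cong-mod (≡-mod-refl {i = + y}) (inverse-≡-mod p pp 1≤n n<p) ⟩
    + y ℤ.* ℤ.1ℤ                    ≡⟨ ℤ.*-identityʳ (+ y) ⟩
    + y                             ∎
    where open ≡-mod-Reasoning p

  quotient∈quotSet : ∀ {a H B x y} → 1 ≤ a → a + H < p → 1 ≤ x → x ≤ H → 1 ≤ y → y ≤ B →
                     T (inQuotSet p a H B (quotient y (a + x)))
  quotient∈quotSet {a} {H} {B} {x} {y} 1≤a a+H<p 1≤x x≤H 1≤y y≤B =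
    any⁺ _ (lose (∈-range 1≤x x≤H) (any⁺ _ (lose (∈-range 1≤y y≤B) (≡⇒≡ᵇ _ _ (≡-mod⇒%≡ p r*[a+x]≡y)))))
    where
    r*[a+x]≡y : + (toℕ (quotient y (a + x)) * (a + x)) ≡ + y mod p
    r*[a+x]≡y = subst (λ i → i ≡ + y mod p) (sym (ℤ.pos-* (toℕ (quotient y (a + x))) (a + x)))
                  (quotient-≡-mod y (≤-trans 1≤a (m≤m+n a x)) (≤-<-trans (+-monoʳ-≤ a x≤H) a+H<p))

2*m<o∧2*n<o⇒m+n<o : ∀ m n {o} → 2 * m < o → 2 * n < o → m + n < o
2*m<o∧2*n<o⇒m+n<o m n {o} 2m<o 2n<o = *-cancelˡ-≤ 2 (begin
  2 * suc (m + n)         ≡⟨ identity m n ⟩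
  suc (2 * m) + suc (2 * n) ≤⟨ +-mono-≤ 2m<o 2n<o ⟩
  o + o                   ≡⟨ cong (_+_ o) (+-identityʳ o) ⟨
  2 * o                   ∎)
  where
  open ≤-Reasoning
  identity : ∀ m n → 2 * suc (m + n) ≡ suc (2 * m) + suc (2 * n)
  identity = solve-∀

module _ {p : ℕ} (pp : Prime p) {a H B : ℕ} (1≤a : 1 ≤ a) (a+H<p : a + H < p)
         (16B²H<p : 16 * (B * B * H) < p) (approx : DirichletApproximation p a (4 * B)) where

  open DirichletApproximation approx

  private
    instance
      p≢0 : NonZero p
      p≢0 = prime⇒nonZero pp

    D : ℕ → ℤ
    D = progression s t

    D≡t[a+x] : ∀ x → D x ≡ + t ℤ.* + (a + x) mod p
    D≡t[a+x] x = from-∣ (subst (+ p ℤ.∣_) (begin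
      s ℤ.- + a ℤ.* + t                ≡⟨ identity s (+ a) (+ t) (+ x) ⟩
      D x ℤ.- + t ℤ.* (+ a ℤ.+ + x)    ≡⟨ cong (λ k → D x ℤ.- + t ℤ.* k) (ℤ.pos-+ a x) ⟨
      D x ℤ.- + t ℤ.* + (a + x)        ∎) (to-∣ s≡at))
      where
      open ≡-Reasoning
      identity : ∀ s a t x → s ℤ.- a ℤ.* t ≡ (s ℤ.+ t ℤ.* x) ℤ.- t ℤ.* (a ℤ.+ x)
      identity = ℤ-Solver.solve-∀

    D-injective : ∀ {x₁ x₂} → D x₁ ≡ D x₂ → x₁ ≡ x₂
    D-injective {x₁} {x₂} Dx₁≡Dx₂ = *-cancelˡ-≡ x₁ x₂ t ⦃ >-nonZero 1≤t ⦄ (ℤ.+-injective (begin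
      + (t * x₁)      ≡⟨ ℤ.pos-* t x₁ ⟩
      + t ℤ.* + x₁    ≡⟨ ℤ+-cancelˡ s _ _ Dx₁≡Dx₂ ⟩
      + t ℤ.* + x₂    ≡⟨ ℤ.pos-* t x₂ ⟨
      + (t * x₂)      ∎))
      where open ≡-Reasoning

    2*y*∣Dx∣<p : ∀ {x y} → x ≤ H → y ≤ B → 2 * (y * ∣ D x ∣) < p
    2*y*∣Dx∣<p {x} {y} x≤H y≤B = *-cancelˡ-≤ 2 (begin
      2 * suc (2 * (y * ∣ D x ∣))                     ≡⟨ regroup (y * ∣ D x ∣) ⟩
      suc (suc (4 * (y * ∣ D x ∣)))                   ≤⟨ s≤s (s≤s (*-monoʳ-≤ 4 (*-mono-≤ y≤B ∣Dx∣≤))) ⟩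
      suc (suc (4 * (B * (∣ s ∣ + 4 * B * H))))       ≡⟨ expand ∣ s ∣ B H ⟩
      suc (∣ s ∣ * (4 * B)) + suc (16 * (B * B * H))  ≤⟨ +-mono-≤ ∣s∣*T<p 16B²H<p ⟩
      p + p                                           ≡⟨ cong (_+_ p) (+-identityʳ p) ⟨
      2 * p                                           ∎)
      where
      open ≤-Reasoning
      ∣Dx∣≤ : ∣ D x ∣ ≤ ∣ s ∣ + 4 * B * H
      ∣Dx∣≤ = ≤-trans (ℤ.∣i+j∣≤∣i∣+∣j∣ s (+ t ℤ.* + x))
                (+-monoʳ-≤ ∣ s ∣ (≤-trans (≤-reflexive (ℤ.abs-* (+ t) (+ x))) (*-mono-≤ t≤T x≤H)))
      regroup : ∀ k → 2 * suc (2 * k) ≡ suc (suc (4 * k))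
      regroup = solve-∀
      expand : ∀ S B H → suc (suc (4 * (B * (S + 4 * B * H)))) ≡ suc (S * (4 * B)) + suc (16 * (B * B * H))
      expand = solve-∀

    module _ {x₁ y₁ x₂ y₂ : ℕ} (x₁≤H : x₁ ≤ H) (y₁≤B : y₁ ≤ B) (x₂≤H : x₂ ≤ H) (y₂≤B : y₂ ≤ B)
             (same : quotient pp y₁ (a + x₁) ≡ quotient pp y₂ (a + x₂)) where

      R : ℤ
      R = + toℕ (quotient pp y₁ (a + x₁))

      R*[a+x]≡y : ∀ {x} y → x ≤ H → quotient pp y₁ (a + x₁) ≡ quotient pp y (a + x) →
                  R ℤ.* + (a + x) ≡ + y mod p
      R*[a+x]≡y {x} y x≤H eq = subst (λ r → + toℕ r ℤ.* + (a + x) ≡ + y mod p) (sym eq)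
        (quotient-≡-mod pp y (≤-trans 1≤a (m≤m+n a x)) (≤-<-trans (+-monoʳ-≤ a x≤H) a+H<p))

      cross-≡-mod : + y₁ ℤ.* D x₂ ≡ + y₂ ℤ.* D x₁ mod p
      cross-≡-mod = begin
        + y₁ ℤ.* D x₂                                   ≈⟨ *-cong-mod (≡-mod-refl {i = + y₁}) (D≡t[a+x] x₂) ⟩
        + y₁ ℤ.* (+ t ℤ.* + (a + x₂))                   ≈⟨ *-cong-mod (R*[a+x]≡y y₁ x₁≤H refl) ≡-mod-refl ⟨
        R ℤ.* + (a + x₁) ℤ.* (+ t ℤ.* + (a + x₂))       ≡⟨ swap R (+ (a + x₁)) (+ t) (+ (a + x₂)) ⟩
        R ℤ.* + (a + x₂) ℤ.* (+ t ℤ.* + (a + x₁))       ≈⟨ *-cong-mod (R*[a+x]≡y y₂ x₂≤H same) ≡-mod-refl ⟩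
        + y₂ ℤ.* (+ t ℤ.* + (a + x₁))                   ≈⟨ *-cong-mod (≡-mod-refl {i = + y₂}) (D≡t[a+x] x₁) ⟨
        + y₂ ℤ.* D x₁                                   ∎
        where
        open ≡-mod-Reasoning p
        swap : ∀ r u t v → r ℤ.* u ℤ.* (t ℤ.* v) ≡ r ℤ.* v ℤ.* (t ℤ.* u)
        swap = ℤ-Solver.solve-∀

      cross-≡ : + y₁ ℤ.* D x₂ ≡ + y₂ ℤ.* D x₁
      cross-≡ = ℤ.i-j≡0⇒i≡j _ _ (n∣i∧∣i∣<n⇒i≡0 (to-∣ cross-≡-mod) (begin-strict
        ∣ + y₁ ℤ.* D x₂ ℤ.- + y₂ ℤ.* D x₁ ∣        ≤⟨ ℤ.∣i-j∣≤∣i∣+∣j∣ (+ y₁ ℤ.* D x₂) (+ y₂ ℤ.* D x₁) ⟩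
        ∣ + y₁ ℤ.* D x₂ ∣ + ∣ + y₂ ℤ.* D x₁ ∣      ≡⟨ cong₂ _+_ (ℤ.abs-* (+ y₁) (D x₂)) (ℤ.abs-* (+ y₂) (D x₁)) ⟩
        y₁ * ∣ D x₂ ∣ + y₂ * ∣ D x₁ ∣              <⟨ 2*m<o∧2*n<o⇒m+n<o (y₁ * ∣ D x₂ ∣) (y₂ * ∣ D x₁ ∣)
                                                        (2*y*∣Dx∣<p x₂≤H y₁≤B) (2*y*∣Dx∣<p x₁≤H y₂≤B) ⟩
        p                                          ∎))
        where open ≤-Reasoning

  quotient-injective : ∀ {x₁ y₁ x₂ y₂} → x₁ ≤ H → 1 ≤ y₁ → y₁ ≤ B → Coprime y₁ ∣ D x₁ ∣ →
                       x₂ ≤ H → y₂ ≤ B → Coprime y₂ ∣ D x₂ ∣ →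
                       quotient pp y₁ (a + x₁) ≡ quotient pp y₂ (a + x₂) → x₁ ≡ x₂ × y₁ ≡ y₂
  quotient-injective {x₁} {suc y} {x₂} {y₂} x₁≤H _ y₁≤B y₁⊥Dx₁ x₂≤H y₂≤B y₂⊥Dx₂ same = x₁≡x₂ , y₁≡y₂
    where
    cross = cross-≡ x₁≤H y₁≤B x₂≤H y₂≤B same
    y₁≡y₂ : suc y ≡ y₂
    y₁≡y₂ = coprime∧coprime∧cross-mul⇒≡ y₁⊥Dx₁ y₂⊥Dx₂
              (trans (sym (ℤ.abs-* (+ suc y) (D x₂))) (trans (cong ∣_∣ cross) (ℤ.abs-* (+ y₂) (D x₁))))
    x₁≡x₂ : x₁ ≡ x₂
    x₁≡x₂ = D-injective (sym (ℤ.*-cancelˡ-≡ (+ suc y) (D x₂) (D x₁)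
                                (trans cross (cong (λ k → + k ℤ.* D x₁) (sym y₁≡y₂)))))

  coprime-pairs≤quotSetCard : ∀ {Y} → Y ≤ B →
    ∑ Y (λ y → count (λ x → coprime? y ∣ progression s t x ∣) H) ≤ quotSetCard p a H B
  coprime-pairs≤quotSetCard {Y} Y≤B =
    ∑count≤length (λ y x → coprime? y ∣ D x ∣) (λ x y → quotient pp y (a + x)) H Y
      (λ ((_ , x₁≤H) , (1≤y₁ , y₁≤Y) , y₁⊥Dx₁) ((_ , x₂≤H) , (_ , y₂≤Y) , y₂⊥Dx₂) →
         quotient-injective x₁≤H 1≤y₁ (≤-trans y₁≤Y Y≤B) y₁⊥Dx₁ x₂≤H (≤-trans y₂≤Y Y≤B) y₂⊥Dx₂)
      (filter (λ r → T? (inQuotSet p a H B r)) (allFin p))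
      (λ {x} {y} ((1≤x , x≤H) , (1≤y , y≤Y) , _) → ∈-filter⁺ (λ r → T? (inQuotSet p a H B r)) (∈-allFin _)
         (quotient∈quotSet pp 1≤a a+H<p 1≤x x≤H 1≤y (≤-trans y≤Y Y≤B)))

n≤16*[n/8] : ∀ n → 8 ≤ n → n ≤ 16 * (n / 8)
n≤16*[n/8] n 8≤n = begin
  n                         ≡⟨ m≡m%n+[m/n]*n n 8 ⟩
  n % 8 + n / 8 * 8         ≤⟨ +-monoˡ-≤ (n / 8 * 8) (<⇒≤ (m%n<n n 8)) ⟩
  8 + n / 8 * 8             ≤⟨ +-monoˡ-≤ (n / 8 * 8) (*-monoʳ-≤ 8 (m≥n⇒m/n>0 8≤n)) ⟩
  8 * (n / 8) + n / 8 * 8   ≡⟨ identity (n / 8) ⟩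
  16 * (n / 8)              ∎
  where
  open ≤-Reasoning
  identity : ∀ k → 8 * k + k * 8 ≡ 16 * k
  identity = solve-∀

quotSetCard-lower-bound : ∀ {p H B a} (pp : Prime p) → 1 ≤ a → B ≤ H → a + H < p → 16 * (B * B * H) < p →
                          16 ≤ B → B * H ≤ 512 * quotSetCard p ⦃ prime⇒nonZero pp ⦄ a H B
quotSetCard-lower-bound {p} {H} {B} {a} pp 1≤a B≤H a+H<p 16B²H<p 16≤B = begin
  B * H                                  ≤⟨ m≤n*m (B * H) 5 ⟩
  5 * (B * H)                            ≤⟨ *-monoʳ-≤ 5 (*-monoˡ-≤ H (n≤16*[n/8] B (≤-trans (m≤m+n 8 8) 16≤B))) ⟩
  5 * (16 * Y * H)                       ≡⟨ regroup Y H ⟩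
  16 * (5 * (H * Y))                     ≤⟨ *-monoʳ-≤ 16 (coprime-sieve H Y t s s⊥t 8Y≤H) ⟩
  16 * (32 * coprime-pairs)              ≡⟨ *-assoc 16 32 coprime-pairs ⟨
  512 * coprime-pairs                    ≤⟨ *-monoʳ-≤ 512 (coprime-pairs≤quotSetCard pp 1≤a a+H<p 16B²H<p approx
                                                                                      (m/n≤m B 8)) ⟩
  512 * quotSetCard p ⦃ prime⇒nonZero pp ⦄ a H B ∎
  where
  open ≤-Reasoning
  Y = B / 8
  1≤B : 1 ≤ B
  1≤B = ≤-trans (s≤s z≤n) 16≤B
  8Y≤H : 8 * Y ≤ H
  8Y≤H = ≤-trans (≤-reflexive (*-comm 8 Y)) (≤-trans (m/n*n≤m B 8) B≤H)
  4B<p : 4 * B < p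
  4B<p = begin-strict
    4 * B            ≤⟨ *-monoˡ-≤ B (m≤m+n 4 12) ⟩
    16 * B           ≤⟨ *-monoʳ-≤ 16 (≤-trans (m≤m*n B (B * H) ⦃ >-nonZero 1≤B*H ⦄)
                                              (≤-reflexive (sym (*-assoc B B H)))) ⟩
    16 * (B * B * H) <⟨ 16B²H<p ⟩
    p                ∎
    where
    1≤B*H : 1 ≤ B * H
    1≤B*H = *-mono-≤ 1≤B (≤-trans 1≤B B≤H)
  approx : DirichletApproximation p a (4 * B)
  approx = dirichlet pp 4B<p (≤-trans 1≤B (m≤n*m B 4))
  open DirichletApproximation approx
  coprime-pairs : ℕ
  coprime-pairs = ∑ Y (λ y → count (λ x → coprime? y ∣ progression s t x ∣) H)
  regroup : ∀ Y H → 5 * (16 * Y * H) ≡ 16 * (5 * (H * Y))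
  regroup = solve-∀

lemma24 : Σ ℕ λ H₀ → Σ ℕ λ K → (1 ≤ K) ×
            ((p H H* a : ℕ) → (pp : Prime p) →
             1 ≤ H → 1 ≤ H* → 1 ≤ a →
             H* ≤ H → a + H < p → 16 * (H* * H* * H) < p → H* ≥ H₀ →
             H* * H ≤ K * quotSetCard p {{prime⇒nonZero pp}} a H H*)
lemma24 = 16 , 512 , s≤s z≤n ,
  λ p H H* a pp _ _ 1≤a H*≤H a+H<p 16H*²H<p H*≥16 →
    quotSetCard-lower-bound {p} {H} {H*} {a} pp 1≤a H*≤H a+H<p 16H*²H<p H*≥16
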